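{- Let $n\ge1$, $e\ge0$, let $\mathcal{J}_n^{(e)}$ be the ideal of $\mathbb{Q}[x_1,\ldots,x_n]$ generated by the polynomials $F_\alpha(x_1,\ldots,x_n)$ for all standard compositions $\alpha$ reaching level $e$, and $R_n^{(e)}=\mathbb{Q}[x_1,\ldots,x_n]/\mathcal{J}_n^{(e)}$. Then $\dim R_n^{(e)}\le C_n^{(e)}$.
   Context: A standard composition $\alpha=[\alpha_1,\ldots,\alpha_k]$ of $d$ is a finite sequence of positive integers with sum $d$; $D(\alpha)=\{\alpha_1,\ldots,\alpha_1+\cdots+\alpha_{k-1}\}$ and $F_\alpha(x_1,\ldots,x_n)=\sum x_{j_1}\cdots x_{j_d}$ over $1\le j_1\le\cdots\le j_d\le n$ with $j_i<j_{i+1}$ whenever $i\in D(\alpha)$. For a finite sequence $\pi$ let $d(\pi)$ be its sum and $\ell(\pi)$ its length; $\alpha$ reaches level $e$ if $\alpha=\pi\rho$ (concatenation) with $\pi$ nonempty and $d(\pi)-\ell(\pi)\ge e$. $C_n^{(e)}$ is the number of lattice paths from $(0,0)$ to $(n+e,n)$ with unit north and east steps all of whose points $(x,y)$ satisfy $x-y\le e$; equivalently the number of sequences $(\tilde\alpha_1,\ldots,\tilde\alpha_n)$ of nonnegative integers with $\tilde\alpha_1+\cdots+\tilde\alpha_j\le e+j-1$ for all $1\le j\le n$. (For $e=0$ this is the Catalan number $C_n$.) -}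

module Defs where

open import Data.Bool using (Bool; true; false; _∧_; if_then_else_)
open import Data.Nat using (ℕ; zero; suc; _+_; _≤_; _≤ᵇ_; _<ᵇ_; _≡ᵇ_)
open import Data.Fin using (Fin; toℕ)
open import Data.List using (List; []; _∷_; _++_; map; concatMap; foldr; length; filterᵇ)
open import Data.Nat.ListAction using (sum)
open import Data.Bool.ListAction using (any)
open import Data.List.Relation.Unary.All using (All)
open import Data.Vec using (Vec; zipWith; tabulate)
open import Data.Vec.Properties using (≡-dec)
import Data.Nat.Properties as ℕP
open import Data.Rational using (ℚ; 0ℚ; 1ℚ; -_; _*_) renaming (_+_ to _+ℚ_)
open import Data.Product using (_×_; _,_; ∃; Σ)
open import Relation.Binary.PropositionalEquality using (_≡_; _≢_)
open import Relation.Nullary using (yes; no)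

-- Polynomials in Q[x_1..x_n] as formal sums of terms (coefficient, exponent vector).
-- Two formal sums represent the same polynomial iff all coefficients agree.

Poly : ℕ → Set
Poly n = List (ℚ × Vec ℕ n)

_⊕_ : ∀ {n} → Poly n → Poly n → Poly n
p ⊕ q = p ++ q

scale : ∀ {n} → ℚ → Poly n → Poly n
scale a p = map (λ { (c , m) → (a * c , m) }) p

neg : ∀ {n} → Poly n → Poly n
neg p = scale (- 1ℚ) p

_⊗_ : ∀ {n} → Poly n → Poly n → Poly n
p ⊗ q = concatMap (λ { (a , m) → map (λ { (b , m') → (a * b , zipWith _+_ m m') }) q }) p

coeff : ∀ {n} → Poly n → Vec ℕ n → ℚ
coeff [] m = 0ℚ
coeff ((a , m') ∷ p) m with ≡-dec ℕP._≟_ m' m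
... | yes _ = a +ℚ coeff p m
... | no _  = coeff p m

_≈ₚ_ : ∀ {n} → Poly n → Poly n → Set
p ≈ₚ q = ∀ m → coeff p m ≡ coeff q m

lincomb : ∀ {n k} → Vec ℚ k → Vec (Poly n) k → Poly n
lincomb Vec.[] Vec.[] = []
lincomb (c Vec.∷ cs) (b Vec.∷ bs) = scale c b ⊕ lincomb cs bs

IsComposition : List ℕ → Set
IsComposition α = All (λ a → 1 ≤ a) α

descents : List ℕ → List ℕ
descents [] = []
descents (a ∷ []) = []
descents (a ∷ b ∷ r) = a ∷ map (a +_) (descents (b ∷ r))

ReachesLevel : ℕ → List ℕ → Set
ReachesLevel e α = Σ (List ℕ) λ π → Σ (List ℕ) λ ρ →
  (α ≡ π ++ ρ) × (π ≢ []) × (e + length π ≤ sum π)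

allSeqs : (n d : ℕ) → List (List (Fin n))
allSeqs n zero = [] ∷ []
allSeqs n (suc d) = concatMap (λ j → map (j ∷_) (allSeqs n d)) (Data.List.allFin n)
  where import Data.List

-- j_1 ≤ ... ≤ j_d with j_i < j_{i+1} whenever i ∈ D; index i starts at 1
validSeq : ∀ {n} → List ℕ → ℕ → List (Fin n) → Bool
validSeq D i (x ∷ y ∷ r) =
  (if any (λ k → k ≡ᵇ i) D then toℕ x <ᵇ toℕ y else toℕ x ≤ᵇ toℕ y)
  ∧ validSeq D (suc i) (y ∷ r)
validSeq D i _ = true

countᵇ : ∀ {n} → Fin n → List (Fin n) → ℕ
countᵇ k [] = 0
countᵇ k (x ∷ xs) = (if toℕ x ≡ᵇ toℕ k then 1 else 0) + countᵇ k xs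

monomial : ∀ {n} → List (Fin n) → Vec ℕ n
monomial js = tabulate (λ k → countᵇ k js)

F : (n : ℕ) → List ℕ → Poly n
F n α = map (λ js → (1ℚ , monomial js)) (filterᵇ (validSeq (descents α) 1) (allSeqs n (sum α)))

InIdeal : (n e : ℕ) → Poly n → Set
InIdeal n e p = Σ (List (Poly n × List ℕ)) λ gs →
  All (λ { (q , α) → IsComposition α × ReachesLevel e α }) gs ×
  (p ≈ₚ foldr (λ { (q , α) acc → (q ⊗ F n α) ⊕ acc }) [] gs)

-- C_n^(e): lattice paths (0,0) → (n+e,n), unit N/E steps (true = east), all points with x - y ≤ e

allBools : ℕ → List (List Bool)
allBools zero = [] ∷ []
allBools (suc k) = map (true ∷_) (allBools k) ++ map (false ∷_) (allBools k)

pathOK : (e tx ty x y : ℕ) → List Bool → Bool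
pathOK e tx ty x y [] = (x ≡ᵇ tx) ∧ (y ≡ᵇ ty)
pathOK e tx ty x y (true ∷ s) = (suc x ≤ᵇ e + y) ∧ pathOK e tx ty (suc x) y s
pathOK e tx ty x y (false ∷ s) = pathOK e tx ty x (suc y) s

C : (n e : ℕ) → ℕ
C n e = length (filterᵇ (pathOK e (n + e) n 0 0) (allBools (n + e + n)))

module Submission where

open import Defs
open import Data.Nat using (ℕ; _≤_)
open import Data.Vec using (Vec)
open import Data.Rational using (ℚ)
open import Data.Product using (Σ; _×_)

open import Algebra.Bundles using (CommutativeMonoid)
import Algebra.Properties.AbelianGroup as AbelianGroupProperties
import Algebra.Properties.CommutativeSemigroup as CommutativeSemigroupProperties
open import Data.Bool using (Bool; true; false; T; _∧_; _∨_; if_then_else_)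
import Data.Bool.Properties as Bool
open import Data.Bool.ListAction using (any)
open import Data.Empty using (⊥-elim)
open import Data.Fin using (Fin; zero; suc; toℕ)
open import Data.List using (List; []; _∷_; _++_; map; foldr; concatMap; filterᵇ; allFin; length)
import Data.List.Properties as List
open import Data.List.Relation.Unary.All using (All; []; _∷_; universal)
import Data.List.Relation.Unary.All.Properties as All
open import Data.Nat using (zero; suc; _+_; _∸_; _<_; _≤?_; s≤s; z≤n; s≤s⁻¹; _≡ᵇ_; _≤ᵇ_; _<ᵇ_)
open import Data.Nat.Induction using (<-rec)
open import Data.Nat.ListAction using (sum)
import Data.Nat.Properties as ℕ
open import Data.Product using (∃; _,_; proj₁; proj₂)
import Data.Product as Product
open import Data.Rational using (0ℚ; 1ℚ; -_; _*_) renaming (_+_ to _+ℚ_)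
import Data.Rational.Properties as ℚ
open import Data.Vec using ([]; _∷_; zipWith; tabulate; replicate) renaming (map to mapᵛ; _++_ to _++ᵛ_)
open import Data.Vec.Membership.Propositional using (_∈_)
open import Data.Vec.Membership.Propositional.Properties using (∈-map⁺; ∈-++⁺ˡ; ∈-++⁺ʳ)
import Data.Vec.Properties as Vec
open import Data.Vec.Relation.Unary.Any using (here; there)
open import Function using (id; _∘_)
open import Function.Bundles using (Equivalence)
open import Level using (0ℓ)
open import Relation.Binary using (IsEquivalence; Setoid)
open import Relation.Binary.PropositionalEquality
import Relation.Binary.Reasoning.Setoid as SetoidReasoning
open import Relation.Nullary using (Dec; yes; no; ¬_)
open import Relation.Nullary.Decidable using (T?)

open AbelianGroupProperties ℚ.+-0-abelianGroup using (//-rightDividesʳ)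
open CommutativeSemigroupProperties (CommutativeMonoid.commutativeSemigroup ℚ.+-0-commutativeMonoid)
  using (interchange)
open CommutativeSemigroupProperties (CommutativeMonoid.commutativeSemigroup ℚ.*-1-commutativeMonoid)
  using (x∙yz≈y∙xz)

-- We prove more, by induction on n: for every e some ≤ C n e polynomials B_n^(e) span
-- Q[x_1..x_n] modulo J_n^(e). In n+1 variables write x₀ for the first one and ι for the
-- embedding of the other n. Sorting the index sequences of F_α by whether they start at x₀ gives
--   F (1 ∷ β)   = ι F (1 ∷ β)   + x₀ · ι F β,
--   F (h+2 ∷ β) = ι F (h+2 ∷ β) + x₀ · F (h+1 ∷ β),
-- so ι F β ∈ J_{n+1}^(e) whenever β reaches level e+1. Now reduce x₀^a ι(q) by induction on a.
-- If a ≤ e, reduce q modulo J_n^(e+1−a) to B_n^(e+1−a); a generator term r F β of that ideal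
-- leaves x₀^a ι(r F β), and since F (a ∷ β) ∈ J_{n+1}^(e), the identities above trade it, one
-- power of x₀ at a time, for terms of smaller x₀-degree. If a > e, do the same with
-- F (e+1) ∈ J_{n+1}^(e). So the x₀^a ι(B_n^(e+1−a)), a ≤ e, span, and there are at most
-- Σ_{a≤e} C n (e+1−a) = C (n+1) e of them.

infix 4 _≈_

-- Wrapping `_≈ₚ_` in a record lets Agda infer both polynomials from a proof of `p ≈ q`.
record _≈_ {n} (p q : Poly n) : Set where
  constructor mk≈
  field coeff-≡ : p ≈ₚ q
open _≈_ public

≈-isEquivalence : ∀ {n} → IsEquivalence (_≈_ {n})
≈-isEquivalence = record
  { refl  = mk≈ λ _ → refl
  ; sym   = λ p≈q → mk≈ λ m → sym (coeff-≡ p≈q m)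
  ; trans = λ p≈q q≈r → mk≈ λ m → trans (coeff-≡ p≈q m) (coeff-≡ q≈r m)
  }

≈-setoid : ℕ → Setoid 0ℓ 0ℓ
≈-setoid n = record { isEquivalence = ≈-isEquivalence {n} }

module _ {n : ℕ} where
  open IsEquivalence (≈-isEquivalence {n}) public
    using () renaming (refl to ≈-refl; sym to ≈-sym; trans to ≈-trans; reflexive to ≈-reflexive)

module ≈-Reasoning {n : ℕ} = SetoidReasoning (≈-setoid n)

coeff-⊕ : ∀ {n} (p q : Poly n) m → coeff (p ⊕ q) m ≡ coeff p m +ℚ coeff q m
coeff-⊕ [] q m = sym (ℚ.+-identityˡ _)
coeff-⊕ ((a , m') ∷ p) q m with Vec.≡-dec ℕ._≟_ m' m
... | yes _ = trans (cong (a +ℚ_) (coeff-⊕ p q m)) (sym (ℚ.+-assoc a _ _))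
... | no _  = coeff-⊕ p q m

⊕-cong : ∀ {n} {p p' q q' : Poly n} → p ≈ p' → q ≈ q' → p ⊕ q ≈ p' ⊕ q'
⊕-cong {p = p} {p'} {q} {q'} p≈p' q≈q' = mk≈ λ m → begin
  coeff (p ⊕ q) m            ≡⟨ coeff-⊕ p q m ⟩
  coeff p m +ℚ coeff q m     ≡⟨ cong₂ _+ℚ_ (coeff-≡ p≈p' m) (coeff-≡ q≈q' m) ⟩
  coeff p' m +ℚ coeff q' m   ≡⟨ coeff-⊕ p' q' m ⟨
  coeff (p' ⊕ q') m          ∎
  where open ≡-Reasoning

⊕-congˡ : ∀ {n} (p : Poly n) {q q'} → q ≈ q' → p ⊕ q ≈ p ⊕ q'
⊕-congˡ p = ⊕-cong (≈-refl {x = p})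

⊕-comm : ∀ {n} (p q : Poly n) → p ⊕ q ≈ q ⊕ p
⊕-comm p q = mk≈ λ m →
  trans (coeff-⊕ p q m) (trans (ℚ.+-comm (coeff p m) (coeff q m)) (sym (coeff-⊕ q p m)))

⊕-identityʳ : ∀ {n} (p : Poly n) → p ⊕ [] ≈ p
⊕-identityʳ p = ≈-reflexive (List.++-identityʳ p)

⊕-interchange : ∀ {n} (p q r s : Poly n) → (p ⊕ q) ⊕ (r ⊕ s) ≈ (p ⊕ r) ⊕ (q ⊕ s)
⊕-interchange p q r s = mk≈ λ m → begin
  coeff ((p ⊕ q) ⊕ (r ⊕ s)) m
    ≡⟨ trans (coeff-⊕ (p ⊕ q) (r ⊕ s) m) (cong₂ _+ℚ_ (coeff-⊕ p q m) (coeff-⊕ r s m)) ⟩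
  (coeff p m +ℚ coeff q m) +ℚ (coeff r m +ℚ coeff s m)
    ≡⟨ interchange (coeff p m) (coeff q m) (coeff r m) (coeff s m) ⟩
  (coeff p m +ℚ coeff r m) +ℚ (coeff q m +ℚ coeff s m)
    ≡⟨ sym (trans (coeff-⊕ (p ⊕ r) (q ⊕ s) m) (cong₂ _+ℚ_ (coeff-⊕ p r m) (coeff-⊕ q s m))) ⟩
  coeff ((p ⊕ r) ⊕ (q ⊕ s)) m ∎
  where open ≡-Reasoning

0ᵛ : ∀ {n} → Vec ℕ n
0ᵛ = tabulate (λ _ → 0)

infixl 6 _+ᵛ_

_+ᵛ_ : ∀ {n} → Vec ℕ n → Vec ℕ n → Vec ℕ n
_+ᵛ_ = zipWith _+_

+ᵛ-identityˡ : ∀ {n} (v : Vec ℕ n) → 0ᵛ +ᵛ v ≡ v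
+ᵛ-identityˡ []      = refl
+ᵛ-identityˡ (x ∷ v) = cong (x ∷_) (+ᵛ-identityˡ v)

+ᵛ-comm : ∀ {n} (u v : Vec ℕ n) → u +ᵛ v ≡ v +ᵛ u
+ᵛ-comm []      []      = refl
+ᵛ-comm (x ∷ u) (y ∷ v) = cong₂ _∷_ (ℕ.+-comm x y) (+ᵛ-comm u v)

+ᵛ-assoc : ∀ {n} (u v w : Vec ℕ n) → (u +ᵛ v) +ᵛ w ≡ u +ᵛ (v +ᵛ w)
+ᵛ-assoc = Vec.zipWith-assoc ℕ.+-assoc

+ᵛ-cancelˡ : ∀ {n} (μ : Vec ℕ n) {u v} → μ +ᵛ u ≡ μ +ᵛ v → u ≡ v
+ᵛ-cancelˡ []      {[]}    {[]}    _  = refl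
+ᵛ-cancelˡ (a ∷ μ) {x ∷ u} {y ∷ v} eq =
  cong₂ _∷_ (ℕ.+-cancelˡ-≡ a x y (Vec.∷-injectiveˡ eq)) (+ᵛ-cancelˡ μ (Vec.∷-injectiveʳ eq))

image-+ᵛ? : ∀ {n} (μ m : Vec ℕ n) → Dec (∃ λ u → μ +ᵛ u ≡ m)
image-+ᵛ? []      []      = yes ([] , refl)
image-+ᵛ? (a ∷ μ) (x ∷ m) with a ≤? x | image-+ᵛ? μ m
... | yes a≤x | yes (u , eq) = yes (x ∸ a ∷ u , cong₂ _∷_ (ℕ.m+[n∸m]≡n a≤x) eq)
... | yes _   | no ¬image    = no λ { (_ ∷ u , eq) → ¬image (u , Vec.∷-injectiveʳ eq) }
... | no a≰x  | _            =
  no λ { (y ∷ _ , eq) → a≰x (subst (a ≤_) (Vec.∷-injectiveˡ eq) (ℕ.m≤m+n a y)) }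

mapTerms : ∀ {n k} → (ℚ → ℚ) → (Vec ℕ n → Vec ℕ k) → Poly n → Poly k
mapTerms h g = map (Product.map h g)

module TermMap {n k} {h : ℚ → ℚ} {g : Vec ℕ n → Vec ℕ k}
  (h-+ : ∀ x y → h (x +ℚ y) ≡ h x +ℚ h y) (h-0 : h 0ℚ ≡ 0ℚ)
  (g-injective : ∀ {u v} → g u ≡ g v → u ≡ v) (g-image? : ∀ m → Dec (∃ λ u → g u ≡ m)) where

  coeff-image : ∀ p u → coeff (mapTerms h g p) (g u) ≡ h (coeff p u)
  coeff-image []            u = sym h-0
  coeff-image ((a , m) ∷ p) u with Vec.≡-dec ℕ._≟_ (g m) (g u) | Vec.≡-dec ℕ._≟_ m u
  ... | yes _   | yes _   = trans (cong (h a +ℚ_) (coeff-image p u)) (sym (h-+ a _))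
  ... | yes gm≡gu | no m≢u = ⊥-elim (m≢u (g-injective gm≡gu))
  ... | no gm≢gu | yes m≡u = ⊥-elim (gm≢gu (cong g m≡u))
  ... | no _    | no _    = coeff-image p u

  coeff-outside : ∀ p {m} → ¬ (∃ λ u → g u ≡ m) → coeff (mapTerms h g p) m ≡ 0ℚ
  coeff-outside []            _      = refl
  coeff-outside ((a , u) ∷ p) {m} ¬image with Vec.≡-dec ℕ._≟_ (g u) m
  ... | yes gu≡m = ⊥-elim (¬image (u , gu≡m))
  ... | no _     = coeff-outside p ¬image

  cong≈ : ∀ {p q} → p ≈ q → mapTerms h g p ≈ mapTerms h g q
  cong≈ {p} {q} p≈q = mk≈ pointwise
    where
    pointwise : ∀ m → coeff (mapTerms h g p) m ≡ coeff (mapTerms h g q) m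
    pointwise m with g-image? m
    ... | yes (u , refl) = trans (coeff-image p u) (trans (cong h (coeff-≡ p≈q u)) (sym (coeff-image q u)))
    ... | no ¬image      = trans (coeff-outside p ¬image) (sym (coeff-outside q ¬image))

module Scale {n} (a : ℚ) =
  TermMap {n} {h = a *_} {g = id} (ℚ.*-distribˡ-+ a) (ℚ.*-zeroʳ a) id (λ m → yes (m , refl))

coeff-scale : ∀ {n} a (p : Poly n) m → coeff (scale a p) m ≡ a * coeff p m
coeff-scale a = Scale.coeff-image a

scale-cong : ∀ {n} a {p q : Poly n} → p ≈ q → scale a p ≈ scale a q
scale-cong a = Scale.cong≈ a

coeff-neg : ∀ {n} (p : Poly n) m → coeff (neg p) m ≡ - coeff p m
coeff-neg p m = trans (coeff-scale (- 1ℚ) p m)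
  (trans (sym (ℚ.neg-distribˡ-* 1ℚ (coeff p m))) (cong -_ (ℚ.*-identityˡ (coeff p m))))

neg-cong : ∀ {n} {p q : Poly n} → p ≈ q → neg p ≈ neg q
neg-cong = scale-cong (- 1ℚ)

-- Multiplication by a x^μ; `((a , μ) ∷ p) ⊗ q` reduces to `shift a μ q ⊕ (p ⊗ q)`.
shift : ∀ {n} → ℚ → Vec ℕ n → Poly n → Poly n
shift a μ = mapTerms (a *_) (μ +ᵛ_)

module Shift {n} (a : ℚ) (μ : Vec ℕ n) =
  TermMap {h = a *_} {g = μ +ᵛ_} (ℚ.*-distribˡ-+ a) (ℚ.*-zeroʳ a) (+ᵛ-cancelˡ μ) (image-+ᵛ? μ)

⊗-congʳ : ∀ {n} (p : Poly n) {q q'} → q ≈ q' → p ⊗ q ≈ p ⊗ q'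
⊗-congʳ []            _    = ≈-refl
⊗-congʳ ((a , μ) ∷ p) q≈q' = ⊕-cong (Shift.cong≈ a μ q≈q') (⊗-congʳ p q≈q')

⊗-distribʳ : ∀ {n} (p p' q : Poly n) → (p ⊕ p') ⊗ q ≡ (p ⊗ q) ⊕ (p' ⊗ q)
⊗-distribʳ []            p' q = refl
⊗-distribʳ ((a , μ) ∷ p) p' q =
  trans (cong (shift a μ q ++_) (⊗-distribʳ p p' q)) (sym (List.++-assoc (shift a μ q) _ _))

⊗-distribˡ : ∀ {n} (q p p' : Poly n) → q ⊗ (p ⊕ p') ≈ (q ⊗ p) ⊕ (q ⊗ p')
⊗-distribˡ []            p p' = ≈-refl
⊗-distribˡ ((a , μ) ∷ q) p p' = ≈-trans
  (⊕-cong (≈-reflexive (List.map-++ _ p p')) (⊗-distribˡ q p p'))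
  (⊕-interchange (shift a μ p) (shift a μ p') (q ⊗ p) (q ⊗ p'))

⊗-zeroʳ : ∀ {n} (p : Poly n) → p ⊗ [] ≡ []
⊗-zeroʳ []            = refl
⊗-zeroʳ ((a , μ) ∷ p) = ⊗-zeroʳ p

shift-shift : ∀ {n} a μ b ν (r : Poly n) → shift a μ (shift b ν r) ≡ shift (a * b) (μ +ᵛ ν) r
shift-shift a μ b ν []            = refl
shift-shift a μ b ν ((c , w) ∷ r) =
  cong₂ _∷_ (cong₂ _,_ (sym (ℚ.*-assoc a b c)) (sym (+ᵛ-assoc μ ν w))) (shift-shift a μ b ν r)

shift-⊗ : ∀ {n} a μ (q r : Poly n) → (shift a μ q ⊗ r) ≡ shift a μ (q ⊗ r)
shift-⊗ a μ []            r = refl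
shift-⊗ a μ ((b , ν) ∷ q) r = begin
  shift (a * b) (μ +ᵛ ν) r ++ (shift a μ q ⊗ r)
    ≡⟨ cong₂ _++_ (sym (shift-shift a μ b ν r)) (shift-⊗ a μ q r) ⟩
  shift a μ (shift b ν r) ++ shift a μ (q ⊗ r)
    ≡⟨ List.map-++ _ (shift b ν r) (q ⊗ r) ⟨
  shift a μ (shift b ν r ++ (q ⊗ r)) ∎
  where open ≡-Reasoning

⊗-assoc : ∀ {n} (p q r : Poly n) → (p ⊗ q) ⊗ r ≡ p ⊗ (q ⊗ r)
⊗-assoc []            q r = refl
⊗-assoc ((a , μ) ∷ p) q r =
  trans (⊗-distribʳ (shift a μ q) (p ⊗ q) r) (cong₂ _++_ (shift-⊗ a μ q r) (⊗-assoc p q r))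

⊗-term : ∀ {n} (q : Poly n) a μ → q ⊗ ((a , μ) ∷ []) ≡ shift a μ q
⊗-term []            a μ = refl
⊗-term ((b , ν) ∷ q) a μ = cong₂ _∷_ (cong₂ _,_ (ℚ.*-comm b a) (+ᵛ-comm ν μ)) (⊗-term q a μ)

⊗-comm : ∀ {n} (p q : Poly n) → p ⊗ q ≈ q ⊗ p
⊗-comm []            q = ≈-reflexive (sym (⊗-zeroʳ q))
⊗-comm ((a , μ) ∷ p) q = ≈-trans
  (⊕-cong (≈-reflexive (sym (⊗-term q a μ))) (⊗-comm p q))
  (≈-sym (⊗-distribˡ q ((a , μ) ∷ []) p))

⊗-congˡ : ∀ {n} {p p' : Poly n} (q : Poly n) → p ≈ p' → p ⊗ q ≈ p' ⊗ q
⊗-congˡ {p = p} {p'} q p≈p' = ≈-trans (⊗-comm p q) (≈-trans (⊗-congʳ q p≈p') (⊗-comm q p'))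

const : ∀ {n} → ℚ → Poly n
const a = (a , 0ᵛ) ∷ []

const-⊗ : ∀ {n} a (p : Poly n) → const a ⊗ p ≈ scale a p
const-⊗ a p = ≈-trans (⊕-identityʳ _)
  (≈-reflexive (List.map-cong (λ t → cong (_ ,_) (+ᵛ-identityˡ (proj₂ t))) p))

scale-+ : ∀ {n} a b (p : Poly n) → scale (a +ℚ b) p ≈ scale a p ⊕ scale b p
scale-+ a b p = mk≈ λ m → begin
  coeff (scale (a +ℚ b) p) m                  ≡⟨ coeff-scale (a +ℚ b) p m ⟩
  (a +ℚ b) * coeff p m                        ≡⟨ ℚ.*-distribʳ-+ (coeff p m) a b ⟩
  a * coeff p m +ℚ b * coeff p m              ≡⟨ cong₂ _+ℚ_ (coeff-scale a p m) (coeff-scale b p m) ⟨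
  coeff (scale a p) m +ℚ coeff (scale b p) m  ≡⟨ coeff-⊕ (scale a p) (scale b p) m ⟨
  coeff (scale a p ⊕ scale b p) m             ∎
  where open ≡-Reasoning

scale-scale : ∀ {n} a b (p : Poly n) → scale a (scale b p) ≡ scale (a * b) p
scale-scale a b p = trans (sym (List.map-∘ p))
  (List.map-cong (λ t → cong (_, proj₂ t) (sym (ℚ.*-assoc a b (proj₁ t)))) p)

scale-neg : ∀ {n} a (p : Poly n) → scale a (neg p) ≡ neg (scale a p)
scale-neg a p = trans (sym (List.map-∘ p))
  (trans (List.map-cong (λ t → cong (_, proj₂ t) (x∙yz≈y∙xz a (- 1ℚ) (proj₁ t))) p) (List.map-∘ p))

scale-zero : ∀ {n} (p : Poly n) → scale 0ℚ p ≈ []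
scale-zero p = mk≈ λ m → trans (coeff-scale 0ℚ p m) (ℚ.*-zeroˡ (coeff p m))

scale-one : ∀ {n} (p : Poly n) → scale 1ℚ p ≡ p
scale-one p = trans (List.map-cong (λ t → cong (_, proj₂ t) (ℚ.*-identityˡ (proj₁ t))) p) (List.map-id p)

⊗-identityˡ : ∀ {n} (p : Poly n) → const 1ℚ ⊗ p ≈ p
⊗-identityˡ p = ≈-trans (const-⊗ 1ℚ p) (≈-reflexive (scale-one p))

⊗-identityʳ : ∀ {n} (p : Poly n) → p ⊗ const 1ℚ ≈ p
⊗-identityʳ p = ≈-trans (⊗-comm p (const 1ℚ)) (⊗-identityˡ p)

⊕-neg-cancelʳ : ∀ {n} (p q : Poly n) → (p ⊕ q) ⊕ neg q ≈ p
⊕-neg-cancelʳ p q = mk≈ λ m → begin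
  coeff ((p ⊕ q) ⊕ neg q) m                 ≡⟨ coeff-⊕ (p ⊕ q) (neg q) m ⟩
  coeff (p ⊕ q) m +ℚ coeff (neg q) m        ≡⟨ cong₂ _+ℚ_ (coeff-⊕ p q m) (coeff-neg q m) ⟩
  (coeff p m +ℚ coeff q m) +ℚ - coeff q m   ≡⟨ //-rightDividesʳ (coeff q m) (coeff p m) ⟩
  coeff p m                                 ∎
  where open ≡-Reasoning

lincomb-zeros : ∀ {n k} (B : Vec (Poly n) k) → lincomb (replicate k 0ℚ) B ≈ []
lincomb-zeros []      = ≈-refl
lincomb-zeros (b ∷ B) = ⊕-cong (scale-zero b) (lincomb-zeros B)

lincomb-+ : ∀ {n k} (cs ds : Vec ℚ k) (B : Vec (Poly n) k) →
  lincomb (zipWith _+ℚ_ cs ds) B ≈ lincomb cs B ⊕ lincomb ds B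
lincomb-+ []       []       []      = ≈-refl
lincomb-+ (c ∷ cs) (d ∷ ds) (b ∷ B) = ≈-trans
  (⊕-cong (scale-+ c d b) (lincomb-+ cs ds B))
  (⊕-interchange (scale c b) (scale d b) (lincomb cs B) (lincomb ds B))

lincomb-scale : ∀ {n k} a (cs : Vec ℚ k) (B : Vec (Poly n) k) →
  lincomb (mapᵛ (a *_) cs) B ≈ scale a (lincomb cs B)
lincomb-scale a []       []      = ≈-refl
lincomb-scale a (c ∷ cs) (b ∷ B) = ≈-trans
  (⊕-cong (≈-reflexive (sym (scale-scale a c b))) (lincomb-scale a cs B))
  (≈-reflexive (sym (List.map-++ _ (scale c b) (lincomb cs B))))

record IsLinear {n k} (f : Poly n → Poly k) : Set where
  field
    cong≈      : ∀ {p q} → p ≈ q → f p ≈ f q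
    ⊕-homo     : ∀ p q → f (p ⊕ q) ≈ f p ⊕ f q
    scale-homo : ∀ a p → f (scale a p) ≈ scale a (f p)

∘-linear : ∀ {n k l} {g : Poly k → Poly l} {f : Poly n → Poly k} →
  IsLinear g → IsLinear f → IsLinear (g ∘ f)
∘-linear {g = g} {f} g-lin f-lin = record
  { cong≈      = G.cong≈ ∘ F.cong≈
  ; ⊕-homo     = λ p q → ≈-trans (G.cong≈ (F.⊕-homo p q)) (G.⊕-homo (f p) (f q))
  ; scale-homo = λ a p → ≈-trans (G.cong≈ (F.scale-homo a p)) (G.scale-homo a (f p))
  }
  where
  module G = IsLinear g-lin
  module F = IsLinear f-lin

record IsSubspace {n} (P : Poly n → Set) : Set where
  field
    ∈-resp-≈ : ∀ {p q} → p ≈ q → P p → P q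
    []∈      : P []
    ⊕∈       : ∀ {p q} → P p → P q → P (p ⊕ q)
    scale∈   : ∀ a {p} → P p → P (scale a p)

  neg∈ : ∀ {p} → P p → P (neg p)
  neg∈ = scale∈ (- 1ℚ)

  cancelʳ∈ : ∀ {p q r} → p ≈ q ⊕ r → P p → P r → P q
  cancelʳ∈ {p} {q} {r} p≈q⊕r Pp Pr =
    ∈-resp-≈ (≈-trans (⊕-cong p≈q⊕r ≈-refl) (⊕-neg-cancelʳ q r)) (⊕∈ Pp (neg∈ Pr))

  cancelˡ∈ : ∀ {p q r} → p ≈ r ⊕ q → P p → P r → P q
  cancelˡ∈ {q = q} {r} p≈r⊕q = cancelʳ∈ (≈-trans p≈r⊕q (⊕-comm r q))

  lincomb∈ : ∀ {k} {B : Vec (Poly n) k} → (∀ {b} → b ∈ B → P b) → ∀ cs → P (lincomb cs B)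
  lincomb∈ {B = []}    _    []       = []∈
  lincomb∈ {B = b ∷ B} B⊆P (c ∷ cs) = ⊕∈ (scale∈ c (B⊆P (here refl))) (lincomb∈ (B⊆P ∘ there) cs)

  monomials⇒all : (∀ m → P ((1ℚ , m) ∷ [])) → ∀ p → P p
  monomials⇒all monomial∈ []            = []∈
  monomials⇒all monomial∈ ((c , m) ∷ p) =
    ⊕∈ (∈-resp-≈ (≈-reflexive (cong (λ a → (a , m) ∷ []) (ℚ.*-identityʳ c))) (scale∈ c (monomial∈ m)))
       (monomials⇒all monomial∈ p)

preimage : ∀ {n k} {P : Poly k → Set} {f : Poly n → Poly k} →
  IsLinear f → IsSubspace P → IsSubspace (P ∘ f)
preimage {f = f} f-lin P-sub = record
  { ∈-resp-≈ = ∈-resp-≈ ∘ cong≈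
  ; []∈      = ∈-resp-≈ (≈-sym (≈-trans (scale-homo 0ℚ []) (scale-zero (f [])))) []∈
  ; ⊕∈       = λ {p} {q} Pfp Pfq → ∈-resp-≈ (≈-sym (⊕-homo p q)) (⊕∈ Pfp Pfq)
  ; scale∈   = λ a {p} Pfp → ∈-resp-≈ (≈-sym (scale-homo a p)) (scale∈ a Pfp)
  }
  where
  open IsLinear f-lin
  open IsSubspace P-sub

ι : ∀ {n} → Poly n → Poly (suc n)
ι = mapTerms id (0 ∷_)

image-0∷? : ∀ {n} (m : Vec ℕ (suc n)) → Dec (∃ λ u → 0 ∷ u ≡ m)
image-0∷? (zero  ∷ m) = yes (m , refl)
image-0∷? (suc _ ∷ _) = no λ ()

ι-linear : ∀ {n} → IsLinear (ι {n})
ι-linear = record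
  { cong≈      = TermMap.cong≈ {h = id} {g = 0 ∷_} (λ _ _ → refl) refl Vec.∷-injectiveʳ image-0∷?
  ; ⊕-homo     = λ p q → ≈-reflexive (List.map-++ _ p q)
  ; scale-homo = λ a p → ≈-reflexive (trans (sym (List.map-∘ p)) (List.map-∘ p))
  }

ι-⊗ : ∀ {n} (p q : Poly n) → ι (p ⊗ q) ≡ ι p ⊗ ι q
ι-⊗ []            q = refl
ι-⊗ ((a , μ) ∷ p) q = trans (List.map-++ _ (shift a μ q) (p ⊗ q))
  (cong₂ _++_ (trans (sym (List.map-∘ q)) (List.map-∘ q)) (ι-⊗ p q))

⊗-linear : ∀ {n} (r : Poly n) → IsLinear (r ⊗_)
⊗-linear r = record
  { cong≈      = ⊗-congʳ r
  ; ⊕-homo     = ⊗-distribˡ r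
  ; scale-homo = λ a p → begin
      r ⊗ scale a p        ≈⟨ ⊗-congʳ r (const-⊗ a p) ⟨
      r ⊗ (const a ⊗ p)    ≡⟨ ⊗-assoc r (const a) p ⟨
      (r ⊗ const a) ⊗ p    ≈⟨ ⊗-congˡ p (⊗-comm r (const a)) ⟩
      (const a ⊗ r) ⊗ p    ≡⟨ ⊗-assoc (const a) r p ⟩
      const a ⊗ (r ⊗ p)    ≈⟨ const-⊗ a (r ⊗ p) ⟩
      scale a (r ⊗ p)      ∎
  }
  where open ≈-Reasoning

x₀^ : ∀ {n} → ℕ → Poly (suc n)
x₀^ a = (1ℚ , a ∷ 0ᵛ) ∷ []

x₀^-+ : ∀ {n} a b → x₀^ {n} a ⊗ x₀^ b ≡ x₀^ (a + b)
x₀^-+ a b = cong₂ (λ c v → (c , a + b ∷ v) ∷ []) (ℚ.*-identityˡ 1ℚ) (+ᵛ-identityˡ 0ᵛ)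

combination : ∀ {n} → List (Poly n × List ℕ) → Poly n
combination {n} = foldr (λ t acc → (proj₁ t ⊗ F n (proj₂ t)) ⊕ acc) []

-- `InIdeal` repackaged as a record over `_≈_`, so that the polynomial is inferable from a proof.
record InJ (n e : ℕ) (p : Poly n) : Set where
  constructor mkInJ
  field
    generators : List (Poly n × List ℕ)
    valid      : All (λ t → IsComposition (proj₂ t) × ReachesLevel e (proj₂ t)) generators
    represents : p ≈ combination generators

InJ⇒InIdeal : ∀ {n e p} → InJ n e p → InIdeal n e p
InJ⇒InIdeal (mkInJ gs ok eq) = gs , ok , coeff-≡ eq

module _ {n e : ℕ} where

  combination-++ : ∀ (gs gs' : List (Poly n × List ℕ)) →
    combination (gs ++ gs') ≡ combination gs ⊕ combination gs'
  combination-++ []            gs' = refl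
  combination-++ ((q , α) ∷ gs) gs' = trans (cong ((q ⊗ F n α) ++_) (combination-++ gs gs'))
    (sym (List.++-assoc (q ⊗ F n α) (combination gs) (combination gs')))

  combination-⊗ˡ : ∀ r (gs : List (Poly n × List ℕ)) →
    r ⊗ combination gs ≈ combination (map (Product.map₁ (r ⊗_)) gs)
  combination-⊗ˡ r []             = ≈-reflexive (⊗-zeroʳ r)
  combination-⊗ˡ r ((q , α) ∷ gs) = ≈-trans (⊗-distribˡ r (q ⊗ F n α) (combination gs))
    (⊕-cong (≈-reflexive (sym (⊗-assoc r q (F n α)))) (combination-⊗ˡ r gs))

  InJ-⊗ˡ : ∀ r {p} → InJ n e p → InJ n e (r ⊗ p)
  InJ-⊗ˡ r (mkInJ gs ok eq) =
    mkInJ (map (Product.map₁ (r ⊗_)) gs) (All.map⁺ ok) (≈-trans (⊗-congʳ r eq) (combination-⊗ˡ r gs))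

  InJ-resp : ∀ {p q} → p ≈ q → InJ n e p → InJ n e q
  InJ-resp p≈q (mkInJ gs ok eq) = mkInJ gs ok (≈-trans (≈-sym p≈q) eq)

  InJ-isSubspace : IsSubspace (InJ n e)
  InJ-isSubspace = record
    { ∈-resp-≈ = InJ-resp
    ; []∈      = mkInJ [] [] ≈-refl
    ; ⊕∈       = λ { (mkInJ gs ok eq) (mkInJ gs' ok' eq') → mkInJ (gs ++ gs') (All.++⁺ ok ok')
                     (≈-trans (⊕-cong eq eq') (≈-reflexive (sym (combination-++ gs gs')))) }
    ; scale∈   = λ a {p} p∈J → InJ-resp (const-⊗ a p) (InJ-⊗ˡ (const a) p∈J)
    }

  InJ-F : ∀ {α} → IsComposition α → ReachesLevel e α → InJ n e (F n α)
  InJ-F {α} comp reach = mkInJ ((const 1ℚ , α) ∷ []) ((comp , reach) ∷ [])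
    (≈-sym (≈-trans (⊕-identityʳ _) (⊗-identityˡ (F n α))))

  InJ⊆ : ∀ {P : Poly n → Set} → IsSubspace P →
    (∀ r α → IsComposition α → ReachesLevel e α → P (r ⊗ F n α)) → ∀ {p} → InJ n e p → P p
  InJ⊆ {P} P-sub generator∈ (mkInJ gs ok eq) = ∈-resp-≈ (≈-sym eq) (combination∈ gs ok)
    where
    open IsSubspace P-sub
    combination∈ : ∀ gs → All (λ t → IsComposition (proj₂ t) × ReachesLevel e (proj₂ t)) gs →
      P (combination gs)
    combination∈ []             []                    = []∈
    combination∈ ((r , α) ∷ gs) ((comp , reach) ∷ ok) = ⊕∈ (generator∈ r α comp reach) (combination∈ gs ok)

record Reducible (n e : ℕ) {k} (B : Vec (Poly n) k) (p : Poly n) : Set where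
  constructor mkReducible
  field
    coefficients : Vec ℚ k
    remainder∈J  : InJ n e (p ⊕ neg (lincomb coefficients B))

module _ {n e k : ℕ} {B : Vec (Poly n) k} where
  open IsSubspace (InJ-isSubspace {n} {e})

  InJ⇒Reducible : ∀ {p} → InJ n e p → Reducible n e B p
  InJ⇒Reducible {p} p∈J = mkReducible (replicate k 0ℚ)
    (InJ-resp (≈-sym (≈-trans (⊕-cong ≈-refl (neg-cong (lincomb-zeros B))) (⊕-identityʳ p))) p∈J)

  Reducible-isSubspace : IsSubspace (Reducible n e B)
  Reducible-isSubspace = record
    { ∈-resp-≈ = λ { p≈q (mkReducible cs rem) → mkReducible cs (InJ-resp (⊕-cong p≈q ≈-refl) rem) }
    ; []∈      = InJ⇒Reducible []∈
    ; ⊕∈       = λ { {p} {q} (mkReducible cs rem) (mkReducible ds rem') → mkReducible (zipWith _+ℚ_ cs ds)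
                     (InJ-resp (sum-of-remainders {p} {q} cs ds) (⊕∈ rem rem')) }
    ; scale∈   = λ { a {p} (mkReducible cs rem) → mkReducible (mapᵛ (a *_) cs)
                     (InJ-resp (scaled-remainder {p} a cs) (scale∈ a rem)) }
    }
    where
    open ≈-Reasoning
    sum-of-remainders : ∀ {p q} cs ds →
      (p ⊕ neg (lincomb cs B)) ⊕ (q ⊕ neg (lincomb ds B)) ≈ (p ⊕ q) ⊕ neg (lincomb (zipWith _+ℚ_ cs ds) B)
    sum-of-remainders {p} {q} cs ds = begin
      (p ⊕ neg (lincomb cs B)) ⊕ (q ⊕ neg (lincomb ds B))
        ≈⟨ ⊕-interchange p (neg (lincomb cs B)) q (neg (lincomb ds B)) ⟩
      (p ⊕ q) ⊕ (neg (lincomb cs B) ⊕ neg (lincomb ds B))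
        ≡⟨ cong ((p ⊕ q) ⊕_) (List.map-++ _ (lincomb cs B) (lincomb ds B)) ⟨
      (p ⊕ q) ⊕ neg (lincomb cs B ⊕ lincomb ds B)
        ≈⟨ ⊕-cong ≈-refl (neg-cong (lincomb-+ cs ds B)) ⟨
      (p ⊕ q) ⊕ neg (lincomb (zipWith _+ℚ_ cs ds) B) ∎
    scaled-remainder : ∀ {p} a cs →
      scale a (p ⊕ neg (lincomb cs B)) ≈ scale a p ⊕ neg (lincomb (mapᵛ (a *_) cs) B)
    scaled-remainder {p} a cs = begin
      scale a (p ⊕ neg (lincomb cs B))          ≡⟨ List.map-++ _ p (neg (lincomb cs B)) ⟩
      scale a p ⊕ scale a (neg (lincomb cs B))  ≡⟨ cong (scale a p ⊕_) (scale-neg a (lincomb cs B)) ⟩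
      scale a p ⊕ neg (scale a (lincomb cs B))  ≈⟨ ⊕-cong ≈-refl (neg-cong (lincomb-scale a cs B)) ⟨
      scale a p ⊕ neg (lincomb (mapᵛ (a *_) cs) B) ∎

  Reducible⊆ : ∀ {P : Poly n → Set} → IsSubspace P → (∀ {b} → b ∈ B → P b) →
    (∀ r α → IsComposition α → ReachesLevel e α → P (r ⊗ F n α)) → ∀ {p} → Reducible n e B p → P p
  Reducible⊆ P-sub B⊆P generator∈ (mkReducible cs rem) =
    P.cancelʳ∈ ≈-refl (InJ⊆ P-sub generator∈ rem) (P.neg∈ (P.lincomb∈ B⊆P cs))
    where module P = IsSubspace P-sub

∈⇒Reducible : ∀ {n e k} {B : Vec (Poly n) k} {b} → b ∈ B → Reducible n e B b
∈⇒Reducible {B = b ∷ B} (here refl) = mkReducible (1ℚ ∷ replicate _ 0ℚ) (InJ-resp b-b≈[] []∈)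
  where
  open IsSubspace InJ-isSubspace using ([]∈)
  b-b≈[] : [] ≈ b ⊕ neg (scale 1ℚ b ⊕ lincomb (replicate _ 0ℚ) B)
  b-b≈[] = ≈-trans (≈-sym (⊕-neg-cancelʳ [] b)) (⊕-cong ≈-refl (neg-cong (≈-sym
    (≈-trans (⊕-cong (≈-reflexive (scale-one b)) (lincomb-zeros B)) (⊕-identityʳ b)))))
∈⇒Reducible {B = b ∷ B} (there b'∈B) with ∈⇒Reducible b'∈B
... | mkReducible cs rem =
  mkReducible (0ℚ ∷ cs) (InJ-resp (⊕-cong ≈-refl (neg-cong (≈-sym (⊕-cong (scale-zero b) ≈-refl)))) rem)

reachesLevel-weaken : ∀ {e e' α} → e ≤ e' → ReachesLevel e' α → ReachesLevel e α
reachesLevel-weaken e≤e' (π , ρ , eq , π≢[] , le) =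
  π , ρ , eq , π≢[] , ℕ.≤-trans (ℕ.+-monoˡ-≤ (length π) e≤e') le

singleton-reachesLevel : ∀ e → ReachesLevel e (suc e ∷ [])
singleton-reachesLevel e = suc e ∷ [] , [] , refl , (λ ()) ,
  ℕ.≤-reflexive (trans (ℕ.+-comm e 1) (sym (ℕ.+-identityʳ (suc e))))

reachesLevel-∷ : ∀ a {l β} → ReachesLevel (suc l) β → ReachesLevel (a + l) (a ∷ β)
reachesLevel-∷ a {l} (π , ρ , refl , _ , le) = a ∷ π , ρ , refl , (λ ()) , (begin
  (a + l) + suc (length π)   ≡⟨ ℕ.+-assoc a l (suc (length π)) ⟩
  a + (l + suc (length π))   ≡⟨ cong (a +_) (ℕ.+-suc l (length π)) ⟩
  a + (suc l + length π)     ≤⟨ ℕ.+-monoʳ-≤ a le ⟩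
  a + sum π                  ∎)
  where open ℕ.≤-Reasoning

reachesLevel-head-pred : ∀ {e h β} → ReachesLevel (suc e) (suc (suc h) ∷ β) → ReachesLevel e (suc h ∷ β)
reachesLevel-head-pred ([]    , _ , _    , π≢[] , _)  = ⊥-elim (π≢[] refl)
reachesLevel-head-pred (_ ∷ π , ρ , refl , _    , le) = _ ∷ π , ρ , refl , (λ ()) , s≤s⁻¹ le

reachesLevel-drop-1 : ∀ {e β} → ReachesLevel (suc e) (1 ∷ β) → ReachesLevel (suc e) β
reachesLevel-drop-1 ([]        , _ , _    , π≢[] , _)  = ⊥-elim (π≢[] refl)
reachesLevel-drop-1 {e} (_ ∷ []    , _ , refl , _ , le)
  with () ← ℕ.≤-trans (ℕ.≤-reflexive (ℕ.+-comm 1 e)) (s≤s⁻¹ le)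
reachesLevel-drop-1 {e} (_ ∷ y ∷ π , ρ , refl , _ , le) =
  y ∷ π , ρ , refl , (λ ()) , ℕ.≤-trans (ℕ.≤-reflexive (sym (ℕ.+-suc e (suc (length π))))) (s≤s⁻¹ le)

-- Splitting F along the first variable

module _ {A : Set} where

  filterᵇ-++ : ∀ (p : A → Bool) xs ys → filterᵇ p (xs ++ ys) ≡ filterᵇ p xs ++ filterᵇ p ys
  filterᵇ-++ p = List.filter-++ (T? ∘ p)

  filterᵇ-cong : ∀ {p q : A → Bool} → (∀ x → p x ≡ q x) → ∀ xs → filterᵇ p xs ≡ filterᵇ q xs
  filterᵇ-cong {p} {q} p≗q = List.filter-≐ (T? ∘ p) (T? ∘ q)
    ((λ {x} → subst T (p≗q x)) , (λ {x} → subst T (sym (p≗q x))))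

  filterᵇ-none : ∀ (p : A → Bool) → (∀ x → p x ≡ false) → ∀ xs → filterᵇ p xs ≡ []
  filterᵇ-none p never xs = List.filter-none (T? ∘ p) (universal (λ x → subst T (never x)) xs)

  filterᵇ-all : ∀ (p : A → Bool) → (∀ x → p x ≡ true) → ∀ xs → filterᵇ p xs ≡ xs
  filterᵇ-all p always xs = List.filter-all (T? ∘ p) (universal (λ x → subst T (sym (always x)) _) xs)

  filterᵇ-∧ : ∀ (p q : A → Bool) xs → filterᵇ (λ x → p x ∧ q x) xs ≡ filterᵇ p (filterᵇ q xs)
  filterᵇ-∧ p q []       = refl
  filterᵇ-∧ p q (x ∷ xs) with q x
  ... | true  with p x
  ...   | true  = cong (x ∷_) (filterᵇ-∧ p q xs)
  ...   | false = filterᵇ-∧ p q xs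
  filterᵇ-∧ p q (x ∷ xs) | false with p x
  ...   | true  = filterᵇ-∧ p q xs
  ...   | false = filterᵇ-∧ p q xs

  filterᵇ-comm : ∀ (p q : A → Bool) xs → filterᵇ p (filterᵇ q xs) ≡ filterᵇ q (filterᵇ p xs)
  filterᵇ-comm p q xs = trans (sym (filterᵇ-∧ p q xs))
    (trans (filterᵇ-cong (λ x → Bool.∧-comm (p x) (q x)) xs) (filterᵇ-∧ q p xs))

  filterᵇ-concatMap : ∀ {B : Set} (p : A → Bool) (f : B → List A) xs →
    filterᵇ p (concatMap f xs) ≡ concatMap (filterᵇ p ∘ f) xs
  filterᵇ-concatMap p f []       = refl
  filterᵇ-concatMap p f (x ∷ xs) =
    trans (filterᵇ-++ p (f x) (concatMap f xs)) (cong (_ ++_) (filterᵇ-concatMap p f xs))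

filterᵇ-map : ∀ {A B : Set} (p : B → Bool) (f : A → B) xs →
  filterᵇ p (map f xs) ≡ map f (filterᵇ (p ∘ f) xs)
filterᵇ-map p f []       = refl
filterᵇ-map p f (x ∷ xs) with p (f x)
... | true  = cong (f x ∷_) (filterᵇ-map p f xs)
... | false = filterᵇ-map p f xs

allSeqs-suc : ∀ n d → allSeqs (suc n) (suc d) ≡
  map (zero ∷_) (allSeqs (suc n) d) ++ concatMap (λ j → map (suc j ∷_) (allSeqs (suc n) d)) (allFin n)
allSeqs-suc n d = cong (map (zero ∷_) (allSeqs (suc n) d) ++_) (trans
  (cong (concatMap block) (sym (List.map-tabulate id suc)))
  (List.concatMap-map block suc (allFin n)))
  where
  block : Fin (suc n) → List (List (Fin (suc n)))
  block j = map (j ∷_) (allSeqs (suc n) d)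

descent? : List ℕ → ℕ → Bool
descent? D i = any (λ k → k ≡ᵇ i) D

stepOK : ∀ {k} → List ℕ → ℕ → Fin k → List (Fin k) → Bool
stepOK D i x []      = true
stepOK D i x (y ∷ _) = if descent? D i then toℕ x <ᵇ toℕ y else toℕ x ≤ᵇ toℕ y

validSeq-∷ : ∀ {k} D i (x : Fin k) s → validSeq D i (x ∷ s) ≡ stepOK D i x s ∧ validSeq D (suc i) s
validSeq-∷ D i x []      = refl
validSeq-∷ D i x (y ∷ s) = refl

filter-validSeq-∷ : ∀ {k} D i (x : Fin k) S → filterᵇ (validSeq D i) (map (x ∷_) S) ≡
  map (x ∷_) (filterᵇ (stepOK D i x) (filterᵇ (validSeq D (suc i)) S))
filter-validSeq-∷ D i x S = trans (filterᵇ-map (validSeq D i) (x ∷_) S)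
  (cong (map (x ∷_)) (trans (filterᵇ-cong (validSeq-∷ D i x) S)
                             (filterᵇ-∧ (stepOK D i x) (validSeq D (suc i)) S)))

≤ᵇ-suc : ∀ a b → (suc a ≤ᵇ suc b) ≡ (a ≤ᵇ b)
≤ᵇ-suc zero    b = refl
≤ᵇ-suc (suc a) b = refl

stepOK-suc : ∀ {k} D i (x : Fin k) s → stepOK D i (suc x) (map suc s) ≡ stepOK D i x s
stepOK-suc D i x []      = refl
stepOK-suc D i x (y ∷ s) with descent? D i
... | true  = refl
... | false = ≤ᵇ-suc (toℕ x) (toℕ y)

stepOK-suc-zero : ∀ {k} D i (x : Fin k) s → stepOK D i (suc x) (zero ∷ s) ≡ false
stepOK-suc-zero D i x s with descent? D i
... | true  = refl
... | false = refl

stepOK-rejects-zero : ∀ {k} D i (x : Fin k) (P : List (Fin (suc k)) → Bool) S →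
  filterᵇ (stepOK D i (suc x)) (filterᵇ P (map (zero ∷_) S)) ≡ []
stepOK-rejects-zero D i x P S = begin
  filterᵇ OK (filterᵇ P (map (zero ∷_) S))
    ≡⟨ cong (filterᵇ OK) (filterᵇ-map P (zero ∷_) S) ⟩
  filterᵇ OK (map (zero ∷_) (filterᵇ (P ∘ (zero ∷_)) S))
    ≡⟨ filterᵇ-map OK (zero ∷_) (filterᵇ (P ∘ (zero ∷_)) S) ⟩
  map (zero ∷_) (filterᵇ (OK ∘ (zero ∷_)) (filterᵇ (P ∘ (zero ∷_)) S))
    ≡⟨ cong (map (zero ∷_)) (filterᵇ-none _ (stepOK-suc-zero D i x) (filterᵇ (P ∘ (zero ∷_)) S)) ⟩
  [] ∎
  where
  open ≡-Reasoning
  OK = stepOK D i (suc x)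

module _ {n : ℕ} where

  private
    shiftedBlocks : ℕ → List (List (Fin (suc n)))
    shiftedBlocks d = concatMap (λ j → map (suc j ∷_) (allSeqs (suc n) d)) (allFin n)

  mutual
    filter-validSeq-shiftedBlock : ∀ d D i (j : Fin n) →
      filterᵇ (validSeq D i) (map (suc j ∷_) (allSeqs (suc n) d)) ≡
      map (map suc) (filterᵇ (validSeq D i) (map (j ∷_) (allSeqs n d)))
    filter-validSeq-shiftedBlock zero    D i j = refl
    filter-validSeq-shiftedBlock (suc d) D i j = begin
      filterᵇ (validSeq D i) (map (suc j ∷_) (allSeqs (suc n) (suc d)))
        ≡⟨ filter-validSeq-∷ D i (suc j) (allSeqs (suc n) (suc d)) ⟩
      map (suc j ∷_) (filterᵇ OK (filterᵇ V (allSeqs (suc n) (suc d))))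
        ≡⟨ cong (map (suc j ∷_)) tails-avoid-zero ⟩
      map (suc j ∷_) (filterᵇ OK (filterᵇ V (shiftedBlocks d)))
        ≡⟨ cong (map (suc j ∷_) ∘ filterᵇ OK) (filter-validSeq-shiftedBlocks d D (suc i)) ⟩
      map (suc j ∷_) (filterᵇ OK (map (map suc) W))
        ≡⟨ cong (map (suc j ∷_)) (filterᵇ-map OK (map suc) W) ⟩
      map (suc j ∷_) (map (map suc) (filterᵇ (OK ∘ map suc) W))
        ≡⟨ cong (map (suc j ∷_) ∘ map (map suc)) (filterᵇ-cong (stepOK-suc D i j) W) ⟩
      map (suc j ∷_) (map (map suc) (filterᵇ (stepOK D i j) W))
        ≡⟨ trans (sym (List.map-∘ _)) (List.map-∘ _) ⟩
      map (map suc) (map (j ∷_) (filterᵇ (stepOK D i j) W))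
        ≡⟨ cong (map (map suc)) (filter-validSeq-∷ D i j (allSeqs n (suc d))) ⟨
      map (map suc) (filterᵇ (validSeq D i) (map (j ∷_) (allSeqs n (suc d)))) ∎
      where
      open ≡-Reasoning
      OK = stepOK D i (suc j)
      V = validSeq D (suc i)
      W = filterᵇ (validSeq D (suc i)) (allSeqs n (suc d))
      S = allSeqs (suc n) d
      Z = map (zero ∷_) S
      tails-avoid-zero :
        filterᵇ OK (filterᵇ V (allSeqs (suc n) (suc d))) ≡ filterᵇ OK (filterᵇ V (shiftedBlocks d))
      tails-avoid-zero = begin
        filterᵇ OK (filterᵇ V (allSeqs (suc n) (suc d)))
          ≡⟨ cong (filterᵇ OK ∘ filterᵇ V) (allSeqs-suc n d) ⟩
        filterᵇ OK (filterᵇ V (Z ++ shiftedBlocks d))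
          ≡⟨ cong (filterᵇ OK) (filterᵇ-++ V Z (shiftedBlocks d)) ⟩
        filterᵇ OK (filterᵇ V Z ++ filterᵇ V (shiftedBlocks d))
          ≡⟨ filterᵇ-++ OK (filterᵇ V Z) (filterᵇ V (shiftedBlocks d)) ⟩
        filterᵇ OK (filterᵇ V Z) ++ filterᵇ OK (filterᵇ V (shiftedBlocks d))
          ≡⟨ cong (_++ filterᵇ OK (filterᵇ V (shiftedBlocks d))) (stepOK-rejects-zero D i j V S) ⟩
        filterᵇ OK (filterᵇ V (shiftedBlocks d)) ∎

    filter-validSeq-shiftedBlocks : ∀ d D i →
      filterᵇ (validSeq D i) (shiftedBlocks d) ≡ map (map suc) (filterᵇ (validSeq D i) (allSeqs n (suc d)))
    filter-validSeq-shiftedBlocks d D i = begin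
      filterᵇ (validSeq D i) (shiftedBlocks d)
        ≡⟨ filterᵇ-concatMap (validSeq D i) _ (allFin n) ⟩
      concatMap (λ j → filterᵇ (validSeq D i) (map (suc j ∷_) (allSeqs (suc n) d))) (allFin n)
        ≡⟨ List.concatMap-cong (filter-validSeq-shiftedBlock d D i) (allFin n) ⟩
      concatMap (λ j → map (map suc) (filterᵇ (validSeq D i) (map (j ∷_) (allSeqs n d)))) (allFin n)
        ≡⟨ List.map-concatMap (map suc) _ (allFin n) ⟨
      map (map suc) (concatMap (λ j → filterᵇ (validSeq D i) (map (j ∷_) (allSeqs n d))) (allFin n))
        ≡⟨ cong (map (map suc)) (filterᵇ-concatMap (validSeq D i) _ (allFin n)) ⟨
      map (map suc) (filterᵇ (validSeq D i) (allSeqs n (suc d))) ∎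
      where open ≡-Reasoning

  filter-validSeq-allSeqs-suc : ∀ D i d → filterᵇ (validSeq D i) (allSeqs (suc n) (suc d)) ≡
    map (zero ∷_) (filterᵇ (stepOK D i zero) (filterᵇ (validSeq D (suc i)) (allSeqs (suc n) d)))
      ++ map (map suc) (filterᵇ (validSeq D i) (allSeqs n (suc d)))
  filter-validSeq-allSeqs-suc D i d = trans (cong (filterᵇ (validSeq D i)) (allSeqs-suc n d))
    (trans (filterᵇ-++ (validSeq D i) (map (zero ∷_) (allSeqs (suc n) d)) (shiftedBlocks d))
           (cong₂ _++_ (filter-validSeq-∷ D i zero (allSeqs (suc n) d)) (filter-validSeq-shiftedBlocks d D i)))

  startsNonzero : List (Fin (suc n)) → Bool
  startsNonzero []          = true
  startsNonzero (zero  ∷ _) = false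
  startsNonzero (suc _ ∷ _) = true

  filter-startsNonzero : ∀ d D i → filterᵇ startsNonzero (filterᵇ (validSeq D i) (allSeqs (suc n) d)) ≡
    map (map suc) (filterᵇ (validSeq D i) (allSeqs n d))
  filter-startsNonzero zero    D i = refl
  filter-startsNonzero (suc d) D i = begin
    filterᵇ startsNonzero (filterᵇ V (allSeqs (suc n) (suc d)))
      ≡⟨ filterᵇ-comm startsNonzero V (allSeqs (suc n) (suc d)) ⟩
    filterᵇ V (filterᵇ startsNonzero (allSeqs (suc n) (suc d)))
      ≡⟨ cong (filterᵇ V ∘ filterᵇ startsNonzero) (allSeqs-suc n d) ⟩
    filterᵇ V (filterᵇ startsNonzero (Z ++ shiftedBlocks d))
      ≡⟨ cong (filterᵇ V) (filterᵇ-++ startsNonzero Z (shiftedBlocks d)) ⟩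
    filterᵇ V (filterᵇ startsNonzero Z ++ filterᵇ startsNonzero (shiftedBlocks d))
      ≡⟨ cong₂ (λ S S' → filterᵇ V (S ++ S')) zero-block-rejected shifted-blocks-accepted ⟩
    filterᵇ V (shiftedBlocks d)
      ≡⟨ filter-validSeq-shiftedBlocks d D i ⟩
    map (map suc) (filterᵇ V (allSeqs n (suc d))) ∎
    where
    open ≡-Reasoning
    V : ∀ {k} → List (Fin k) → Bool
    V = validSeq D i
    Z = map (zero ∷_) (allSeqs (suc n) d)
    zero-block-rejected : filterᵇ startsNonzero Z ≡ []
    zero-block-rejected = trans (filterᵇ-map startsNonzero (zero ∷_) (allSeqs (suc n) d))
      (cong (map (zero ∷_)) (filterᵇ-none _ (λ _ → refl) (allSeqs (suc n) d)))
    shifted-blocks-accepted : filterᵇ startsNonzero (shiftedBlocks d) ≡ shiftedBlocks d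
    shifted-blocks-accepted = trans (filterᵇ-concatMap startsNonzero _ (allFin n))
      (List.concatMap-cong (λ j → trans (filterᵇ-map startsNonzero (suc j ∷_) (allSeqs (suc n) d))
        (cong (map (suc j ∷_)) (filterᵇ-all _ (λ _ → refl) (allSeqs (suc n) d)))) (allFin n))

descents-suc : ∀ h β → descents (suc h ∷ β) ≡ map suc (descents (h ∷ β))
descents-suc h []      = refl
descents-suc h (b ∷ β) = cong (suc h ∷_) (List.map-∘ (descents (b ∷ β)))

descent?-map-suc : ∀ D i → descent? (map suc D) (suc i) ≡ descent? D i
descent?-map-suc []      i = refl
descent?-map-suc (k ∷ D) i = cong ((k ≡ᵇ i) ∨_) (descent?-map-suc D i)

descent?-map-suc-0 : ∀ D → descent? (map suc D) 0 ≡ false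
descent?-map-suc-0 []      = refl
descent?-map-suc-0 (_ ∷ D) = descent?-map-suc-0 D

validSeq-map-suc : ∀ {k} D i (s : List (Fin k)) → validSeq (map suc D) (suc i) s ≡ validSeq D i s
validSeq-map-suc D i []          = refl
validSeq-map-suc D i (x ∷ [])    = refl
validSeq-map-suc D i (x ∷ y ∷ s) = cong₂ _∧_
  (cong (λ b → if b then toℕ x <ᵇ toℕ y else toℕ x ≤ᵇ toℕ y) (descent?-map-suc D i))
  (validSeq-map-suc D (suc i) (y ∷ s))

validSeq-1∷map-suc : ∀ {k} D i (s : List (Fin k)) →
  validSeq (1 ∷ map suc D) (suc (suc i)) s ≡ validSeq D (suc i) s
validSeq-1∷map-suc D i []          = refl
validSeq-1∷map-suc D i (x ∷ [])    = refl
validSeq-1∷map-suc D i (x ∷ y ∷ s) = cong₂ _∧_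
  (cong (λ b → if b then toℕ x <ᵇ toℕ y else toℕ x ≤ᵇ toℕ y) (descent?-map-suc D (suc i)))
  (validSeq-1∷map-suc D (suc i) (y ∷ s))

term : ∀ {k} → List (Fin k) → ℚ × Vec ℕ k
term js = 1ℚ , monomial js

monomial-map-suc : ∀ {k} (s : List (Fin k)) → monomial (map suc s) ≡ 0 ∷ monomial s
monomial-map-suc s = cong₂ _∷_ (count-zero s) (Vec.tabulate-cong (λ k → count-suc k s))
  where
  count-zero : ∀ {k} (s : List (Fin k)) → countᵇ zero (map suc s) ≡ 0
  count-zero []      = refl
  count-zero (_ ∷ s) = count-zero s
  count-suc : ∀ {k} (j : Fin k) s → countᵇ (suc j) (map suc s) ≡ countᵇ j s
  count-suc j []      = refl
  count-suc j (x ∷ s) = cong (_ +_) (count-suc j s)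

monomial-zero∷ : ∀ {k} (s : List (Fin (suc k))) → monomial (zero ∷ s) ≡ (1 ∷ 0ᵛ) +ᵛ monomial s
monomial-zero∷ s = cong (suc (countᵇ zero s) ∷_) (sym (+ᵛ-identityˡ _))

map-term-map-suc : ∀ {k} (W : List (List (Fin k))) → map term (map (map suc) W) ≡ ι (map term W)
map-term-map-suc W = trans (sym (List.map-∘ W))
  (trans (List.map-cong (λ s → cong (1ℚ ,_) (monomial-map-suc s)) W) (List.map-∘ W))

map-term-zero∷ : ∀ {k} (W : List (List (Fin (suc k)))) → map term (map (zero ∷_) W) ≈ x₀^ 1 ⊗ map term W
map-term-zero∷ W = ≈-sym (≈-trans (⊕-identityʳ _) (≈-reflexive (trans (sym (List.map-∘ W))
  (trans (List.map-cong (λ s → cong₂ _,_ (ℚ.*-identityˡ 1ℚ) (sym (monomial-zero∷ s))) W) (List.map-∘ W)))))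

zeroTails : ∀ {n} → List ℕ → ℕ → List (List (Fin (suc n)))
zeroTails D d = filterᵇ (stepOK D 1 zero) (filterᵇ (validSeq D 2) (allSeqs _ d))

F-suc-split : ∀ {n} a β →
  F (suc n) (suc a ∷ β) ≈ ι (F n (suc a ∷ β)) ⊕ (x₀^ 1 ⊗ map term (zeroTails (descents (suc a ∷ β)) (a + sum β)))
F-suc-split {n} a β = begin
  F (suc n) α
    ≡⟨ cong (map term) (filter-validSeq-allSeqs-suc D 1 (a + sum β)) ⟩
  map term (map (zero ∷_) Z ++ map (map suc) (filterᵇ (validSeq D 1) (allSeqs n (sum α))))
    ≡⟨ List.map-++ term (map (zero ∷_) Z) _ ⟩
  map term (map (zero ∷_) Z) ⊕ map term (map (map suc) (filterᵇ (validSeq D 1) (allSeqs n (sum α))))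
    ≈⟨ ⊕-cong (map-term-zero∷ Z) (≈-reflexive (map-term-map-suc _)) ⟩
  (x₀^ 1 ⊗ map term Z) ⊕ ι (F n α)
    ≈⟨ ⊕-comm (x₀^ 1 ⊗ map term Z) (ι (F n α)) ⟩
  ι (F n α) ⊕ (x₀^ 1 ⊗ map term Z) ∎
  where
  open ≈-Reasoning
  α = suc a ∷ β
  D = descents α
  Z = zeroTails D (a + sum β)

F-split-1 : ∀ {n} β → F (suc n) (1 ∷ β) ≈ ι (F n (1 ∷ β)) ⊕ (x₀^ 1 ⊗ ι (F n β))
F-split-1 {n} β = ≈-trans (F-suc-split 0 β) (⊕-congˡ (ι (F n (1 ∷ β))) (⊗-congʳ (x₀^ 1)
  (≈-reflexive (trans (cong (map term) (zero-part β)) (map-term-map-suc _)))))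
  where
  zero-part : ∀ β → zeroTails (descents (1 ∷ β)) (sum β) ≡
    map (map suc) (filterᵇ (validSeq (descents β) 1) (allSeqs n (sum β)))
  zero-part []      = refl
  zero-part (b ∷ β) = trans
    (trans (filterᵇ-cong (stepOK-1-zero (map suc D)) (filterᵇ (validSeq (1 ∷ map suc D) 2) A))
           (cong (filterᵇ startsNonzero) (filterᵇ-cong (validSeq-1∷map-suc D 0) A)))
    (filter-startsNonzero (sum (b ∷ β)) D 1)
    where
    D = descents (b ∷ β)
    A = allSeqs (suc n) (sum (b ∷ β))
    stepOK-1-zero : ∀ Y s → stepOK (1 ∷ Y) 1 zero s ≡ startsNonzero s
    stepOK-1-zero Y []          = refl
    stepOK-1-zero Y (zero  ∷ _) = refl
    stepOK-1-zero Y (suc _ ∷ _) = refl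

F-split-suc : ∀ {n} h β →
  F (suc n) (suc (suc h) ∷ β) ≈ ι (F n (suc (suc h) ∷ β)) ⊕ (x₀^ 1 ⊗ F (suc n) (suc h ∷ β))
F-split-suc {n} h β = ≈-trans (F-suc-split (suc h) β)
  (⊕-congˡ (ι (F n (suc (suc h) ∷ β))) (⊗-congʳ (x₀^ 1) (≈-reflexive (cong (map term) zero-part))))
  where
  open ≡-Reasoning
  D = descents (suc h ∷ β)
  A = allSeqs (suc n) (suc h + sum β)
  no-descent-at-1 : descent? (map suc D) 1 ≡ false
  no-descent-at-1 = begin
    descent? (map suc D) 1                    ≡⟨ descent?-map-suc D 0 ⟩
    descent? D 0                              ≡⟨ cong (λ D → descent? D 0) (descents-suc h β) ⟩
    descent? (map suc (descents (h ∷ β))) 0   ≡⟨ descent?-map-suc-0 (descents (h ∷ β)) ⟩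
    false                                     ∎
  first-step-free : ∀ s → stepOK (map suc D) 1 zero s ≡ true
  first-step-free []      = refl
  first-step-free (y ∷ _) = cong (λ b → if b then 0 <ᵇ toℕ y else true) no-descent-at-1
  zero-part : zeroTails (descents (suc (suc h) ∷ β)) (suc h + sum β) ≡ filterᵇ (validSeq D 1) A
  zero-part = begin
    zeroTails (descents (suc (suc h) ∷ β)) (suc h + sum β)
      ≡⟨ cong (λ D → zeroTails D (suc h + sum β)) (descents-suc (suc h) β) ⟩
    filterᵇ (stepOK (map suc D) 1 zero) (filterᵇ (validSeq (map suc D) 2) A)
      ≡⟨ filterᵇ-all _ first-step-free _ ⟩
    filterᵇ (validSeq (map suc D) 2) A
      ≡⟨ filterᵇ-cong (validSeq-map-suc D 1) A ⟩
    filterᵇ (validSeq D 1) A ∎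

-- Counting lattice paths

paths : (e tx ty x y L : ℕ) → ℕ
paths e tx ty x y L = length (filterᵇ (pathOK e tx ty x y) (allBools L))

paths-suc : ∀ e tx ty x y L → paths e tx ty x y (suc L) ≡
    length (filterᵇ (λ s → (suc x ≤ᵇ e + y) ∧ pathOK e tx ty (suc x) y s) (allBools L))
    + paths e tx ty x (suc y) L
paths-suc e tx ty x y L = begin
  length (filterᵇ P (map (true ∷_) AB ++ map (false ∷_) AB))
    ≡⟨ cong length (filterᵇ-++ P (map (true ∷_) AB) (map (false ∷_) AB)) ⟩
  length (filterᵇ P (map (true ∷_) AB) ++ filterᵇ P (map (false ∷_) AB))
    ≡⟨ List.length-++ (filterᵇ P (map (true ∷_) AB)) ⟩
  length (filterᵇ P (map (true ∷_) AB)) + length (filterᵇ P (map (false ∷_) AB))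
    ≡⟨ cong₂ _+_ (first-step true) (first-step false) ⟩
  length (filterᵇ (P ∘ (true ∷_)) AB) + length (filterᵇ (P ∘ (false ∷_)) AB) ∎
  where
  open ≡-Reasoning
  P = pathOK e tx ty x y
  AB = allBools L
  first-step : ∀ b → length (filterᵇ P (map (b ∷_) AB)) ≡ length (filterᵇ (P ∘ (b ∷_)) AB)
  first-step b =
    trans (cong length (filterᵇ-map P (b ∷_) AB)) (List.length-map (b ∷_) (filterᵇ (P ∘ (b ∷_)) AB))

paths-east : ∀ {e tx ty x y} L → suc x ≤ e + y →
  paths e tx ty x y (suc L) ≡ paths e tx ty (suc x) y L + paths e tx ty x (suc y) L
paths-east {e} {tx} {ty} {x} {y} L east-allowed = trans (paths-suc e tx ty x y L)
  (cong (λ b → length (filterᵇ (λ s → b ∧ pathOK e tx ty (suc x) y s) (allBools L))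
               + paths e tx ty x (suc y) L)
        (Equivalence.to Bool.T-≡ (ℕ.≤⇒≤ᵇ east-allowed)))

paths-north : ∀ e tx ty x y L → paths e tx ty x (suc y) L ≤ paths e tx ty x y (suc L)
paths-north e tx ty x y L = ℕ.≤-trans (ℕ.m≤n+m _ _) (ℕ.≤-reflexive (sym (paths-suc e tx ty x y L)))

pathOK-shiftˣ : ∀ e tx ty x y s → pathOK (suc e) (suc tx) ty (suc x) y s ≡ pathOK e tx ty x y s
pathOK-shiftˣ e tx ty x y []          = refl
pathOK-shiftˣ e tx ty x y (true ∷ s)  =
  cong₂ _∧_ (≤ᵇ-suc (suc x) (e + y)) (pathOK-shiftˣ e tx ty (suc x) y s)
pathOK-shiftˣ e tx ty x y (false ∷ s) = pathOK-shiftˣ e tx ty x (suc y) s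

pathOK-shiftʸ : ∀ e tx ty x y s → pathOK e tx (suc ty) x (suc y) s ≡ pathOK (suc e) tx ty x y s
pathOK-shiftʸ e tx ty x y []          = refl
pathOK-shiftʸ e tx ty x y (true ∷ s)  =
  cong₂ _∧_ (cong (suc x ≤ᵇ_) (ℕ.+-suc e y)) (pathOK-shiftʸ e tx ty (suc x) y s)
pathOK-shiftʸ e tx ty x y (false ∷ s) = pathOK-shiftʸ e tx ty x (suc y) s

paths-first-east : ∀ {e tx ty L} → paths (suc e) (suc tx) ty 1 0 L ≡ paths e tx ty 0 0 L
paths-first-east {e} {tx} {ty} {L} = cong length (filterᵇ-cong (pathOK-shiftˣ e tx ty 0 0) (allBools L))

C-east-north : ∀ n d → C n (suc d) ≡ C n d + paths (suc d) (n + suc d) n 0 1 (n + d + n)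
C-east-north n d = begin
  C n (suc d)
    ≡⟨ cong (paths (suc d) (n + suc d) n 0 0) (cong (_+ n) (ℕ.+-suc n d)) ⟩
  paths (suc d) (n + suc d) n 0 0 (suc (n + d + n))
    ≡⟨ paths-east (n + d + n) (s≤s z≤n) ⟩
  paths (suc d) (n + suc d) n 1 0 (n + d + n) + north
    ≡⟨ cong (λ tx → paths (suc d) tx n 1 0 (n + d + n) + north) (ℕ.+-suc n d) ⟩
  paths (suc d) (suc (n + d)) n 1 0 (n + d + n) + north
    ≡⟨ cong (_+ north) (paths-first-east {d} {n + d} {n} {n + d + n}) ⟩
  C n d + north ∎
  where
  open ≡-Reasoning
  north = paths (suc d) (n + suc d) n 0 1 (n + d + n)

paths-first-north : ∀ {e tx ty L L'} → L ≡ L' → paths e tx (suc ty) 0 1 L ≡ paths (suc e) tx ty 0 0 L'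
paths-first-north {e} {tx} {ty} {L} refl =
  cong length (filterᵇ-cong (pathOK-shiftʸ e tx ty 0 0) (allBools L))

ΣC : ℕ → ℕ → ℕ
ΣC n zero    = C n 1
ΣC n (suc d) = ΣC n d + C n (suc (suc d))

-- Splitting paths by their first step gives C (n+1) e = C n 1 + C n 2 + ... + C n (e+1).
ΣC≤C : ∀ n d → ΣC n d ≤ C (suc n) d
ΣC≤C n zero = begin
  C n 1
    ≡⟨ cong (λ tx → paths 1 tx n 0 0 (n + 1 + n)) n+1≡suc-n+0 ⟩
  paths 1 (suc n + 0) n 0 0 (n + 1 + n)
    ≡⟨ paths-first-north lengths ⟨
  paths 0 (suc n + 0) (suc n) 0 1 (n + 0 + suc n)
    ≤⟨ paths-north 0 (suc n + 0) (suc n) 0 0 (n + 0 + suc n) ⟩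
  C (suc n) 0 ∎
  where
  open ℕ.≤-Reasoning
  n+1≡suc-n+0 : n + 1 ≡ suc n + 0
  n+1≡suc-n+0 = trans (ℕ.+-comm n 1) (sym (ℕ.+-identityʳ (suc n)))
  lengths : n + 0 + suc n ≡ n + 1 + n
  lengths = trans (cong (_+ suc n) (ℕ.+-identityʳ n)) (trans (ℕ.+-suc n n) (cong (_+ n) (ℕ.+-comm 1 n)))
ΣC≤C n (suc d) = begin
  ΣC n d + C n (suc (suc d))
    ≤⟨ ℕ.+-monoˡ-≤ _ (ΣC≤C n d) ⟩
  C (suc n) d + C n (suc (suc d))
    ≡⟨ cong (λ tx → C (suc n) d + paths (suc (suc d)) tx n 0 0 (n + suc (suc d) + n)) (ℕ.+-suc n (suc d)) ⟩
  C (suc n) d + paths (suc (suc d)) (suc n + suc d) n 0 0 (n + suc (suc d) + n)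
    ≡⟨ cong (C (suc n) d +_) (paths-first-north lengths) ⟨
  C (suc n) d + paths (suc d) (suc n + suc d) (suc n) 0 1 (suc n + d + suc n)
    ≡⟨ C-east-north (suc n) d ⟨
  C (suc n) (suc d) ∎
  where
  open ℕ.≤-Reasoning
  lengths : suc n + d + suc n ≡ n + suc (suc d) + n
  lengths = trans (cong suc (ℕ.+-suc (n + d) n))
    (sym (cong (_+ n) (trans (ℕ.+-suc n (suc d)) (cong suc (ℕ.+-suc n d)))))

1≤C0 : ∀ e → 1 ≤ C 0 e
1≤C0 zero    = ℕ.≤-refl
1≤C0 (suc e) = ℕ.≤-trans (1≤C0 e) (ℕ.≤-trans (ℕ.m≤m+n _ _) (ℕ.≤-reflexive (sym (C-east-north 0 e))))

-- The induction on the number of variables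

InJ-ιF : ∀ {n e β} → IsComposition β → ReachesLevel (suc e) β → InJ (suc n) e (ι (F n β))
InJ-ιF {β = []} _ ([]    , _ , _  , π≢[] , _) = ⊥-elim (π≢[] refl)
InJ-ιF {β = []} _ (_ ∷ _ , _ , () , _)
InJ-ιF {n} {e} {suc zero ∷ β} comp@(_ ∷ comp-β) reach =
  cancelʳ∈ (F-split-1 β) (InJ-F comp (reachesLevel-weaken (ℕ.n≤1+n e) reach))
    (InJ-⊗ˡ (x₀^ 1) (InJ-ιF comp-β (reachesLevel-drop-1 reach)))
  where open IsSubspace InJ-isSubspace
InJ-ιF {n} {e} {suc (suc h) ∷ β} comp@(_ ∷ comp-β) reach =
  cancelʳ∈ (F-split-suc h β) (InJ-F comp (reachesLevel-weaken (ℕ.n≤1+n e) reach))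
    (InJ-⊗ˡ (x₀^ 1) (InJ-F (s≤s z≤n ∷ comp-β) (reachesLevel-head-pred reach)))
  where open IsSubspace InJ-isSubspace

Spanning : ℕ → ℕ → Set
Spanning n e = Σ ℕ λ k → k ≤ C n e × Σ (Vec (Poly n) k) λ B → ∀ p → Reducible n e B p

spanning-0 : ∀ e → Spanning 0 e
spanning-0 e = 1 , 1≤C0 e , const 1ℚ ∷ [] , monomials⇒all (λ { [] → ∈⇒Reducible (here refl) })
  where open IsSubspace Reducible-isSubspace

module Step (n : ℕ) (IH : ∀ l → Spanning n l) where

  k : ℕ → ℕ
  k l = proj₁ (IH l)

  B : ∀ l → Vec (Poly n) (k l)
  B l = proj₁ (proj₂ (proj₂ (IH l)))

  size : ℕ → ℕ
  size zero    = k 1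
  size (suc d) = k (suc (suc d)) + size d

  -- blocks s d = x₀^s ι(B (d+1)) ++ x₀^(s+1) ι(B d) ++ … ++ x₀^(s+d) ι(B 1)
  blocks : ℕ → ∀ d → Vec (Poly (suc n)) (size d)
  blocks s zero    = mapᵛ (λ b → x₀^ s ⊗ ι b) (B 1)
  blocks s (suc d) = mapᵛ (λ b → x₀^ s ⊗ ι b) (B (suc (suc d))) ++ᵛ blocks (suc s) d

  size≤ΣC : ∀ d → size d ≤ ΣC n d
  size≤ΣC zero    = proj₁ (proj₂ (IH 1))
  size≤ΣC (suc d) = ℕ.≤-trans (ℕ.≤-reflexive (ℕ.+-comm (k (suc (suc d))) (size d)))
    (ℕ.+-mono-≤ (size≤ΣC d) (proj₁ (proj₂ (IH (suc (suc d))))))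

  ∈-blocks : ∀ s j l {b} → b ∈ B (suc l) → x₀^ (j + s) ⊗ ι b ∈ blocks s (j + l)
  ∈-blocks s zero    zero    b∈B = ∈-map⁺ _ b∈B
  ∈-blocks s zero    (suc l) b∈B = ∈-++⁺ˡ (∈-map⁺ _ b∈B)
  ∈-blocks s (suc j) l {b} b∈B = ∈-++⁺ʳ _
    (subst (λ a → x₀^ a ⊗ ι b ∈ blocks (suc s) (j + l)) (ℕ.+-suc j s) (∈-blocks (suc s) j l b∈B))

  Basis : ∀ e → Vec (Poly (suc n)) (size e)
  Basis e = blocks 0 e

  RedB : ℕ → Poly (suc n) → Set
  RedB e = Reducible (suc n) e (Basis e)

  Below : ℕ → ℕ → Set
  Below e a = ∀ {j} → j < a → ∀ q → RedB e (x₀^ j ⊗ ι q)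

  x₀-step : ∀ {e} q j {P G R} → G ≈ ι P ⊕ (x₀^ 1 ⊗ R) →
    RedB e (x₀^ j ⊗ (ι q ⊗ G)) → RedB e (x₀^ j ⊗ ι (q ⊗ P)) → RedB e (x₀^ (suc j) ⊗ (ι q ⊗ R))
  x₀-step q j {P} {G} {R} G≈ = cancelˡ∈ (begin
    x₀^ j ⊗ (ι q ⊗ G)
      ≈⟨ ⊗-congʳ (x₀^ j) (⊗-congʳ (ι q) G≈) ⟩
    x₀^ j ⊗ (ι q ⊗ (ι P ⊕ (x₀^ 1 ⊗ R)))
      ≈⟨ ⊗-congʳ (x₀^ j) (⊗-distribˡ (ι q) (ι P) (x₀^ 1 ⊗ R)) ⟩
    x₀^ j ⊗ ((ι q ⊗ ι P) ⊕ (ι q ⊗ (x₀^ 1 ⊗ R)))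
      ≈⟨ ⊗-distribˡ (x₀^ j) (ι q ⊗ ι P) (ι q ⊗ (x₀^ 1 ⊗ R)) ⟩
    (x₀^ j ⊗ (ι q ⊗ ι P)) ⊕ (x₀^ j ⊗ (ι q ⊗ (x₀^ 1 ⊗ R)))
      ≈⟨ ⊕-cong (≈-reflexive (cong (x₀^ j ⊗_) (sym (ι-⊗ q P)))) x₀-commutes ⟩
    (x₀^ j ⊗ ι (q ⊗ P)) ⊕ (x₀^ (suc j) ⊗ (ι q ⊗ R)) ∎)
    where
    open ≈-Reasoning
    open IsSubspace Reducible-isSubspace
    x₀-commutes : x₀^ j ⊗ (ι q ⊗ (x₀^ 1 ⊗ R)) ≈ x₀^ (suc j) ⊗ (ι q ⊗ R)
    x₀-commutes = begin
      x₀^ j ⊗ (ι q ⊗ (x₀^ 1 ⊗ R))    ≡⟨ cong (x₀^ j ⊗_) (⊗-assoc (ι q) (x₀^ 1) R) ⟨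
      x₀^ j ⊗ ((ι q ⊗ x₀^ 1) ⊗ R)    ≈⟨ ⊗-congʳ (x₀^ j) (⊗-congˡ R (⊗-comm (ι q) (x₀^ 1))) ⟩
      x₀^ j ⊗ ((x₀^ 1 ⊗ ι q) ⊗ R)    ≡⟨ cong (x₀^ j ⊗_) (⊗-assoc (x₀^ 1) (ι q) R) ⟩
      x₀^ j ⊗ (x₀^ 1 ⊗ (ι q ⊗ R))    ≡⟨ ⊗-assoc (x₀^ j) (x₀^ 1) (ι q ⊗ R) ⟨
      (x₀^ j ⊗ x₀^ 1) ⊗ (ι q ⊗ R)    ≡⟨ cong (_⊗ (ι q ⊗ R)) (trans (x₀^-+ j 1) (cong x₀^ (ℕ.+-comm j 1))) ⟩
      x₀^ (suc j) ⊗ (ι q ⊗ R)        ∎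

  peel : ∀ {e} c s q β → Below e (suc c + s) →
    RedB e (x₀^ s ⊗ (ι q ⊗ F (suc n) (suc c ∷ β))) → RedB e (x₀^ (suc c + s) ⊗ (ι q ⊗ ι (F n β)))
  peel zero    s q β below red = x₀-step q s (F-split-1 β) red (below (ℕ.n<1+n s) (q ⊗ F n (1 ∷ β)))
  peel {e} (suc c) s q β below red = subst (λ a → RedB e (x₀^ a ⊗ (ι q ⊗ ι (F n β)))) exponent
    (peel c (suc s) q β (λ {j} → below ∘ subst (j <_) exponent)
      (x₀-step q s (F-split-suc c β) red (below (ℕ.m<n+m s (s≤s z≤n)) (q ⊗ F n (suc (suc c) ∷ β)))))
    where
    exponent : suc c + suc s ≡ suc (suc c) + s
    exponent = cong suc (ℕ.+-suc c s)

  generator-reduces : ∀ a l r β → IsComposition β → ReachesLevel (suc l) β → Below (a + l) a →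
    RedB (a + l) (x₀^ a ⊗ ι (r ⊗ F n β))
  generator-reduces zero l r β comp reach _ = InJ⇒Reducible
    (InJ-resp (≈-sym (≈-trans (⊗-identityˡ _) (≈-reflexive (ι-⊗ r (F n β)))))
      (InJ-⊗ˡ (ι r) (InJ-ιF comp reach)))
  generator-reduces (suc a) l r β comp reach below =
    subst (RedB (suc a + l)) (cong₂ (λ a' p → x₀^ a' ⊗ p) (ℕ.+-identityʳ (suc a)) (sym (ι-⊗ r (F n β))))
      (peel a 0 r β (λ {j} → below ∘ subst (j <_) (ℕ.+-identityʳ (suc a)))
        (InJ⇒Reducible (InJ-resp (≈-sym (⊗-identityˡ _))
          (InJ-⊗ˡ (ι r) (InJ-F (s≤s z≤n ∷ comp) (reachesLevel-∷ (suc a) reach))))))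

  reduce-step : ∀ e a → Below e a → ∀ q → RedB e (x₀^ a ⊗ ι q)
  reduce-step e a below q with a ≤? e
  ... | yes a≤e with ℕ.m≤n⇒∃[o]m+o≡n a≤e
  ...   | l , refl = Reducible⊆ (preimage (∘-linear (⊗-linear (x₀^ a)) ι-linear) Reducible-isSubspace)
                       basis∈ (λ r β comp reach → generator-reduces a l r β comp reach below)
                       (proj₂ (proj₂ (proj₂ (IH (suc l)))) q)
    where
    basis∈ : ∀ {b} → b ∈ B (suc l) → RedB (a + l) (x₀^ a ⊗ ι b)
    basis∈ {b} b∈B = ∈⇒Reducible
      (subst (λ a' → x₀^ a' ⊗ ι b ∈ Basis (a + l)) (ℕ.+-identityʳ a) (∈-blocks 0 a l b∈B))
  reduce-step e a below q | no a≰e with ℕ.m≤n⇒∃[o]m+o≡n (ℕ.≰⇒> a≰e)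
  ...   | o , refl = ∈-resp-≈ (⊗-congʳ (x₀^ (suc e + o)) (⊗-identityʳ (ι q)))
    (peel e o q [] below (InJ⇒Reducible (InJ-resp (≈-reflexive (⊗-assoc (x₀^ o) (ι q) _))
      (InJ-⊗ˡ (x₀^ o ⊗ ι q) (InJ-F (s≤s z≤n ∷ []) (singleton-reachesLevel e))))))
    where open IsSubspace Reducible-isSubspace

  spanning-suc : ∀ e → Spanning (suc n) e
  spanning-suc e = size e , ℕ.≤-trans (size≤ΣC e) (ΣC≤C n e) , Basis e , monomials⇒all monomial-reduces
    where
    open IsSubspace Reducible-isSubspace
    monomial-reduces : ∀ m → RedB e ((1ℚ , m) ∷ [])
    monomial-reduces (m₀ ∷ m) = ∈-resp-≈
        (≈-reflexive (cong₂ (λ c v → (c , v) ∷ []) (ℚ.*-identityˡ 1ℚ)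
                          (cong₂ _∷_ (ℕ.+-identityʳ m₀) (+ᵛ-identityˡ m))))
      (<-rec (λ a → ∀ q → RedB e (x₀^ a ⊗ ι q)) (reduce-step e) m₀ ((1ℚ , m) ∷ []))

spanning : ∀ n e → Spanning n e
spanning zero    = spanning-0
spanning (suc n) = Step.spanning-suc n (spanning n)

corollary4p3 : (n e : ℕ) → 1 ≤ n →
    Σ ℕ λ k → (k ≤ C n e) × Σ (Vec (Poly n) k) λ bs →
      (p : Poly n) → Σ (Vec ℚ k) λ cs → InIdeal n e (p ⊕ neg (lincomb cs bs))
-- The bound holds for n = 0 as well.
corollary4p3 n e _ with spanning n e
... | k , k≤C , B , reducible = k , k≤C , B , λ p →
  Reducible.coefficients (reducible p) , InJ⇒InIdeal (Reducible.remainder∈J (reducible p))
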